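{- If $G_1$ and $G_2$ are 3-balanced finite graphs, then so are their Cartesian product $G_1\Box G_2$, their tensor product $G_1\times G_2$, and their strong product $G_1\boxtimes G_2$.
   Context: A graph is 3-balanced if it admits a vertex coloring $\ell:V\to\mathbb{Z}_3$ such that every vertex has, in its open neighborhood, the same number of vertices of each of the three colors. All three products have vertex set $V(G_1)\times V(G_2)$; in $G_1\Box G_2$, $(u,v)\sim(u',v')$ iff ($u=u'$ and $vv'\in E(G_2)$) or ($v=v'$ and $uu'\in E(G_1)$); in $G_1\times G_2$, $(u,v)\sim(u',v')$ iff $uu'\in E(G_1)$ and $vv'\in E(G_2)$; the edge set of $G_1\boxtimes G_2$ is the union of those of $G_1\Box G_2$ and $G_1\times G_2$. -}

module Defs where

open import Data.Nat using (ℕ; _*_)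
open import Data.Fin using (Fin; _≟_; combine; remQuot)
open import Data.List using (List; length; filter)
open import Data.List using () renaming (allFin to allFinL)
open import Data.Product using (Σ; _×_; _,_; proj₁; proj₂)
open import Data.Sum using (_⊎_)
open import Relation.Nullary using (¬_; Dec)
open import Relation.Nullary.Decidable using (_×-dec_; _⊎-dec_)
open import Relation.Binary.PropositionalEquality using (_≡_)

record Graph (n : ℕ) : Set₁ where
  field
    Adj    : Fin n → Fin n → Set
    adj?   : ∀ u v → Dec (Adj u v)
    sym    : ∀ {u v} → Adj u v → Adj v u
    irrefl : ∀ {u} → ¬ Adj u u
open Graph public

-- Colours: elements of ℤ₃, represented as Fin 3.
Colouring : ℕ → Set
Colouring n = Fin n → Fin 3

nbrCount : ∀ {n} (G : Graph n) (ℓ : Colouring n) (v : Fin n) (c : Fin 3) → ℕ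
nbrCount {n} G ℓ v c =
  length (filter (λ w → adj? G v w ×-dec (ℓ w ≟ c)) (allFinL n))

ThreeBalanced : ∀ {n} → Graph n → Set
ThreeBalanced {n} G =
  Σ (Colouring n) (λ ℓ → ∀ (v : Fin n) (c d : Fin 3) → nbrCount G ℓ v c ≡ nbrCount G ℓ v d)

-- Vertex set of a product: Fin (n * m), identified with Fin n × Fin m
-- via combine / remQuot.
fst : ∀ n m → Fin (n * m) → Fin n
fst n m x = proj₁ (remQuot {n} m x)

snd : ∀ n m → Fin (n * m) → Fin m
snd n m x = proj₂ (remQuot {n} m x)

□-Adj : ∀ {n m} → Graph n → Graph m → Fin (n * m) → Fin (n * m) → Set
□-Adj {n} {m} G H x y =
  (fst n m x ≡ fst n m y × Adj H (snd n m x) (snd n m y)) ⊎ (snd n m x ≡ snd n m y × Adj G (fst n m x) (fst n m y))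

×-Adj : ∀ {n m} → Graph n → Graph m → Fin (n * m) → Fin (n * m) → Set
×-Adj {n} {m} G H x y = Adj G (fst n m x) (fst n m y) × Adj H (snd n m x) (snd n m y)

⊠-Adj : ∀ {n m} → Graph n → Graph m → Fin (n * m) → Fin (n * m) → Set
⊠-Adj G H x y = □-Adj G H x y ⊎ ×-Adj G H x y

_□_ : ∀ {n m} → Graph n → Graph m → Graph (n * m)
_□_ {n} {m} G H = record
  { Adj = □-Adj G H
  ; adj? = λ x y → ((fst n m x ≟ fst n m y) ×-dec adj? H (snd n m x) (snd n m y))
                   ⊎-dec ((snd n m x ≟ snd n m y) ×-dec adj? G (fst n m x) (fst n m y))
  ; sym = λ { (Data.Sum.inj₁ (e , a)) → Data.Sum.inj₁ (Eq.sym e , sym H a)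
            ; (Data.Sum.inj₂ (e , a)) → Data.Sum.inj₂ (Eq.sym e , sym G a) }
  ; irrefl = λ { (Data.Sum.inj₁ (_ , a)) → irrefl H a
               ; (Data.Sum.inj₂ (_ , a)) → irrefl G a }
  }
  where import Relation.Binary.PropositionalEquality as Eq

_⨯_ : ∀ {n m} → Graph n → Graph m → Graph (n * m)
_⨯_ {n} {m} G H = record
  { Adj = ×-Adj G H
  ; adj? = λ x y → adj? G (fst n m x) (fst n m y) ×-dec adj? H (snd n m x) (snd n m y)
  ; sym = λ (a , b) → sym G a , sym H b
  ; irrefl = λ (a , _) → irrefl G a
  }

_⊠_ : ∀ {n m} → Graph n → Graph m → Graph (n * m)
_⊠_ {n} {m} G H = record
  { Adj = ⊠-Adj G H
  ; adj? = λ x y → adj? (G □ H) x y ⊎-dec adj? (G ⨯ H) x y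
  ; sym = λ { (Data.Sum.inj₁ a) → Data.Sum.inj₁ (sym (G □ H) a)
            ; (Data.Sum.inj₂ a) → Data.Sum.inj₂ (sym (G ⨯ H) a) }
  ; irrefl = λ { (Data.Sum.inj₁ a) → irrefl (G □ H) a
               ; (Data.Sum.inj₂ a) → irrefl (G ⨯ H) a }
  }

{-# OPTIONS --safe #-}

-- Colour (u , v) by ℓ₁ u + ℓ₂ v in ℤ₃.  Because b ↦ a + b permutes ℤ₃, a vertex (u , v) of
-- G₁ □ G₂ has N₂(v, c − ℓ₁ u) + N₁(u, c − ℓ₂ v) neighbours of colour c, and a vertex of
-- G₁ × G₂ has the sum of N₂(v, c − ℓ₁ a) over the neighbours a of u, where Nᵢ(w, c) is the
-- number of neighbours of colour c of w in Gᵢ.  If the factors are balanced, neither count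
-- depends on c (for × only the balance of G₂ is needed).  The edge set of G₁ ⊠ G₂ is the
-- disjoint union of the other two, so its counts are the sums of theirs.

module Submission where

open import Defs hiding (sym)
open import Data.Bool.Base using (true; false; if_then_else_)
open import Data.Fin using (Fin; zero; suc; toℕ; combine; _↑ˡ_; _↑ʳ_; _≟_)
open import Data.Fin.Properties using (remQuot-combine; all?)
open import Data.List using (length; filter; tabulate)
open import Data.Nat using (ℕ; zero; suc; _+_; _*_; _∸_)
open import Data.Nat.DivMod using (_mod_)
open import Data.Nat.Properties using (+-assoc; +-comm; +-identityʳ; *-assoc; *-identityˡ; *-distribʳ-+; +-0-monoid; +-*-semiring)
open import Data.Product using (_×_; _,_; uncurry)
open import Data.Sum using (_⊎_; inj₁; inj₂)
open import Function.Base using (_∘_; id)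
open import Function.Bundles using (_⇔_; mk⇔)
open import Relation.Nullary using (¬_; Dec; yes; no; does)
open import Relation.Nullary.Decidable using (_×-dec_; _⊎-dec_; _→-dec_; does-⇔; from-yes)
open import Relation.Nullary.Negation using (contradiction)
open import Relation.Unary using (Pred; Decidable)
open import Relation.Binary.PropositionalEquality
open ≡-Reasoning
open import Algebra.Properties.Monoid.Sum +-0-monoid using (sum-syntax; sum-cong-≗; sum-replicate-zero)
open import Algebra.Properties.Semiring.Sum +-*-semiring using (∑-distrib-+; *-distribˡ-sum)

𝟙 : ∀ {p} {P : Set p} → Dec P → ℕ
𝟙 P? = if does P? then 1 else 0

module _ {p q} {P : Set p} {Q : Set q} where

  𝟙-⇔ : P ⇔ Q → (P? : Dec P) (Q? : Dec Q) → 𝟙 P? ≡ 𝟙 Q?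
  𝟙-⇔ P⇔Q P? Q? = cong (λ b → if b then 1 else 0) (does-⇔ P⇔Q P? Q?)

  𝟙-× : (P? : Dec P) (Q? : Dec Q) → 𝟙 (P? ×-dec Q?) ≡ 𝟙 P? * 𝟙 Q?
  𝟙-× (yes _) Q? = sym (*-identityˡ (𝟙 Q?))
  𝟙-× (no _)  Q? = refl

  𝟙-⊎ : ¬ (P × Q) → (P? : Dec P) (Q? : Dec Q) → 𝟙 (P? ⊎-dec Q?) ≡ 𝟙 P? + 𝟙 Q?
  𝟙-⊎ ¬P×Q (yes p) (yes q) = contradiction (p , q) ¬P×Q
  𝟙-⊎ _    (yes _) (no _)  = refl
  𝟙-⊎ _    (no _)  _       = refl

length-filter-tabulate : ∀ {a p n} {A : Set a} {P : Pred A p} (P? : Decidable P) (f : Fin n → A) →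
                         length (filter P? (tabulate f)) ≡ ∑[ i < n ] 𝟙 (P? (f i))
length-filter-tabulate {n = zero}  P? f = refl
length-filter-tabulate {n = suc n} P? f with does (P? (f zero))
... | true  = cong suc (length-filter-tabulate P? (f ∘ suc))
... | false = length-filter-tabulate P? (f ∘ suc)

∑-δ : ∀ {n} (u : Fin n) (f : Fin n → ℕ) → ∑[ i < n ] (𝟙 (u ≟ i) * f i) ≡ f u
∑-δ {suc n} zero    f = trans (cong₂ _+_ (*-identityˡ (f zero)) (sum-replicate-zero n)) (+-identityʳ (f zero))
∑-δ {suc n} (suc u) f = ∑-δ u (f ∘ suc)

∑-cross : ∀ {n m} (u : Fin n) (v : Fin m) (X Y : Fin n → Fin m → ℕ) →
          ∑[ i < n ] ∑[ j < m ] (𝟙 (u ≟ i) * X i j + 𝟙 (v ≟ j) * Y i j) ≡ ∑[ j < m ] X u j + ∑[ i < n ] Y i v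
∑-cross {n} {m} u v X Y = begin
  ∑[ i < n ] ∑[ j < m ] (𝟙 (u ≟ i) * X i j + 𝟙 (v ≟ j) * Y i j)
    ≡⟨ sum-cong-≗ (λ i → ∑-distrib-+ (λ j → 𝟙 (u ≟ i) * X i j) (λ j → 𝟙 (v ≟ j) * Y i j)) ⟩
  ∑[ i < n ] (∑[ j < m ] (𝟙 (u ≟ i) * X i j) + ∑[ j < m ] (𝟙 (v ≟ j) * Y i j))
    ≡⟨ ∑-distrib-+ (λ i → ∑[ j < m ] (𝟙 (u ≟ i) * X i j)) (λ i → ∑[ j < m ] (𝟙 (v ≟ j) * Y i j)) ⟩
  ∑[ i < n ] ∑[ j < m ] (𝟙 (u ≟ i) * X i j) + ∑[ i < n ] ∑[ j < m ] (𝟙 (v ≟ j) * Y i j)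
    ≡⟨ cong₂ _+_ (sum-cong-≗ (λ i → sym (*-distribˡ-sum (𝟙 (u ≟ i)) (X i))))
                 (sum-cong-≗ (λ i → ∑-δ v (Y i))) ⟩
  ∑[ i < n ] (𝟙 (u ≟ i) * ∑[ j < m ] X i j) + ∑[ i < n ] Y i v
    ≡⟨ cong (_+ ∑[ i < n ] Y i v) (∑-δ u (λ i → ∑[ j < m ] X i j)) ⟩
  ∑[ j < m ] X u j + ∑[ i < n ] Y i v ∎

∑-splitAt : ∀ m k (f : Fin (m + k) → ℕ) →
            ∑[ i < m + k ] f i ≡ ∑[ i < m ] f (i ↑ˡ k) + ∑[ j < k ] f (m ↑ʳ j)
∑-splitAt zero    k f = refl
∑-splitAt (suc m) k f = trans (cong (f zero +_) (∑-splitAt m k (f ∘ suc))) (sym (+-assoc (f zero) _ _))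

∑-combine : ∀ n m (f : Fin (n * m) → ℕ) → ∑[ x < n * m ] f x ≡ ∑[ i < n ] ∑[ j < m ] f (combine i j)
∑-combine zero    m f = refl
∑-combine (suc n) m f = trans (∑-splitAt m (n * m) f)
                              (cong (∑[ j < m ] f (j ↑ˡ (n * m)) +_) (∑-combine n m (f ∘ (m ↑ʳ_))))

∑-remQuot : ∀ n m (F : Fin n → Fin m → ℕ) →
            ∑[ x < n * m ] F (fst n m x) (snd n m x) ≡ ∑[ i < n ] ∑[ j < m ] F i j
∑-remQuot n m F = trans (∑-combine n m _)
                        (sum-cong-≗ λ i → sum-cong-≗ λ j → cong (uncurry F) (remQuot-combine i j))

_⊕_ : Fin 3 → Fin 3 → Fin 3
a ⊕ b = (toℕ a + toℕ b) mod 3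

_⊖_ : Fin 3 → Fin 3 → Fin 3
c ⊖ a = (toℕ c + (3 ∸ toℕ a)) mod 3

⊕-comm : ∀ a b → a ⊕ b ≡ b ⊕ a
⊕-comm a b = cong (_mod 3) (+-comm (toℕ a) (toℕ b))

⊕≡⇔≡⊖ : ∀ a b c → a ⊕ b ≡ c ⇔ b ≡ c ⊖ a
⊕≡⇔≡⊖ a b c = mk⇔ (⊕≡⇒≡⊖ a b c) (≡⊖⇒⊕≡ a b c)
  where
  ⊕≡⇒≡⊖ : ∀ x y z → x ⊕ y ≡ z → y ≡ z ⊖ x
  ⊕≡⇒≡⊖ = from-yes (all? λ x → all? λ y → all? λ z → (x ⊕ y ≟ z) →-dec (y ≟ z ⊖ x))

  ≡⊖⇒⊕≡ : ∀ x y z → y ≡ z ⊖ x → x ⊕ y ≡ z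
  ≡⊖⇒⊕≡ = from-yes (all? λ x → all? λ y → all? λ z → (y ≟ z ⊖ x) →-dec (x ⊕ y ≟ z))

nbrCount≡∑ : ∀ {n} (G : Graph n) (ℓ : Colouring n) v c →
             nbrCount G ℓ v c ≡ ∑[ w < n ] (𝟙 (adj? G v w) * 𝟙 (ℓ w ≟ c))
nbrCount≡∑ G ℓ v c = trans (length-filter-tabulate (λ w → adj? G v w ×-dec (ℓ w ≟ c)) id)
                           (sum-cong-≗ λ w → 𝟙-× (adj? G v w) (ℓ w ≟ c))

nbrCount-⊕ˡ : ∀ {n} (G : Graph n) (ℓ : Colouring n) v a c →
              ∑[ w < n ] (𝟙 (adj? G v w) * 𝟙 (a ⊕ ℓ w ≟ c)) ≡ nbrCount G ℓ v (c ⊖ a)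
nbrCount-⊕ˡ G ℓ v a c =
  trans (sum-cong-≗ λ w → cong (𝟙 (adj? G v w) *_) (𝟙-⇔ (⊕≡⇔≡⊖ a (ℓ w) c) (a ⊕ ℓ w ≟ c) (ℓ w ≟ c ⊖ a)))
        (sym (nbrCount≡∑ G ℓ v (c ⊖ a)))

nbrCount-⊕ʳ : ∀ {n} (G : Graph n) (ℓ : Colouring n) v a c →
              ∑[ w < n ] (𝟙 (adj? G v w) * 𝟙 (ℓ w ⊕ a ≟ c)) ≡ nbrCount G ℓ v (c ⊖ a)
nbrCount-⊕ʳ G ℓ v a c =
  trans (sum-cong-≗ λ w → cong (λ b → 𝟙 (adj? G v w) * 𝟙 (b ≟ c)) (⊕-comm (ℓ w) a))
        (nbrCount-⊕ˡ G ℓ v a c)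

Balanced : ∀ {n} → Graph n → Colouring n → Set
Balanced G ℓ = ∀ v c d → nbrCount G ℓ v c ≡ nbrCount G ℓ v d

_⊞_ : ∀ {n m} → Colouring n → Colouring m → Colouring (n * m)
_⊞_ {n} {m} ℓ₁ ℓ₂ x = ℓ₁ (fst n m x) ⊕ ℓ₂ (snd n m x)

module _ {n m} (G : Graph n) (H : Graph m) where

  □-⨯-disjoint : ∀ x y → ¬ (Adj (G □ H) x y × Adj (G ⨯ H) x y)
  □-⨯-disjoint x y (inj₁ (u≡u′ , _) , (uu′ , _)) = irrefl G (subst (Adj G _) (sym u≡u′) uu′)
  □-⨯-disjoint x y (inj₂ (v≡v′ , _) , (_ , vv′)) = irrefl H (subst (Adj H _) (sym v≡v′) vv′)

  ⊠-nbrCount : ∀ (ℓ : Colouring (n * m)) x c →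
               nbrCount (G ⊠ H) ℓ x c ≡ nbrCount (G □ H) ℓ x c + nbrCount (G ⨯ H) ℓ x c
  ⊠-nbrCount ℓ x c = begin
    nbrCount (G ⊠ H) ℓ x c
      ≡⟨ nbrCount≡∑ (G ⊠ H) ℓ x c ⟩
    ∑[ y < n * m ] (𝟙 (adj? (G ⊠ H) x y) * colour y)
      ≡⟨ sum-cong-≗ (λ y → cong (_* colour y) (𝟙-⊎ (□-⨯-disjoint x y) (adj? (G □ H) x y) (adj? (G ⨯ H) x y))) ⟩
    ∑[ y < n * m ] ((edge□ y + edge⨯ y) * colour y)
      ≡⟨ sum-cong-≗ (λ y → *-distribʳ-+ (colour y) (edge□ y) (edge⨯ y)) ⟩
    ∑[ y < n * m ] (edge□ y * colour y + edge⨯ y * colour y)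
      ≡⟨ ∑-distrib-+ (λ y → edge□ y * colour y) (λ y → edge⨯ y * colour y) ⟩
    ∑[ y < n * m ] (edge□ y * colour y) + ∑[ y < n * m ] (edge⨯ y * colour y)
      ≡⟨ cong₂ _+_ (nbrCount≡∑ (G □ H) ℓ x c) (nbrCount≡∑ (G ⨯ H) ℓ x c) ⟨
    nbrCount (G □ H) ℓ x c + nbrCount (G ⨯ H) ℓ x c ∎
    where
    edge□ edge⨯ colour : Fin (n * m) → ℕ
    edge□ y = 𝟙 (adj? (G □ H) x y)
    edge⨯ y = 𝟙 (adj? (G ⨯ H) x y)
    colour y = 𝟙 (ℓ y ≟ c)

  module _ (ℓ₁ : Colouring n) (ℓ₂ : Colouring m) where

    □-nbrCount : ∀ x c → let u = fst n m x; v = snd n m x in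
                 nbrCount (G □ H) (ℓ₁ ⊞ ℓ₂) x c ≡ nbrCount H ℓ₂ v (c ⊖ ℓ₁ u) + nbrCount G ℓ₁ u (c ⊖ ℓ₂ v)
    □-nbrCount x c = begin
      nbrCount (G □ H) (ℓ₁ ⊞ ℓ₂) x c
        ≡⟨ nbrCount≡∑ (G □ H) (ℓ₁ ⊞ ℓ₂) x c ⟩
      ∑[ y < n * m ] (𝟙 (adj? (G □ H) x y) * 𝟙 ((ℓ₁ ⊞ ℓ₂) y ≟ c))
        ≡⟨ ∑-remQuot n m (λ i j → 𝟙 (□-adj? i j) * colour i j) ⟩
      ∑[ i < n ] ∑[ j < m ] (𝟙 (□-adj? i j) * colour i j)
        ≡⟨ sum-cong-≗ (λ i → sum-cong-≗ (λ j → split i j)) ⟩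
      ∑[ i < n ] ∑[ j < m ] (𝟙 (u ≟ i) * (𝟙 (adj? H v j) * colour i j) + 𝟙 (v ≟ j) * (𝟙 (adj? G u i) * colour i j))
        ≡⟨ ∑-cross u v (λ i j → 𝟙 (adj? H v j) * colour i j) (λ i j → 𝟙 (adj? G u i) * colour i j) ⟩
      ∑[ j < m ] (𝟙 (adj? H v j) * colour u j) + ∑[ i < n ] (𝟙 (adj? G u i) * colour i v)
        ≡⟨ cong₂ _+_ (nbrCount-⊕ˡ H ℓ₂ v (ℓ₁ u) c) (nbrCount-⊕ʳ G ℓ₁ u (ℓ₂ v) c) ⟩
      nbrCount H ℓ₂ v (c ⊖ ℓ₁ u) + nbrCount G ℓ₁ u (c ⊖ ℓ₂ v) ∎
      where
      u : Fin n
      u = fst n m x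
      v : Fin m
      v = snd n m x
      colour : Fin n → Fin m → ℕ
      colour i j = 𝟙 (ℓ₁ i ⊕ ℓ₂ j ≟ c)
      □-adj? : ∀ i j → Dec ((u ≡ i × Adj H v j) ⊎ (v ≡ j × Adj G u i))
      □-adj? i j = ((u ≟ i) ×-dec adj? H v j) ⊎-dec ((v ≟ j) ×-dec adj? G u i)
      split : ∀ i j → 𝟙 (□-adj? i j) * colour i j
                    ≡ 𝟙 (u ≟ i) * (𝟙 (adj? H v j) * colour i j) + 𝟙 (v ≟ j) * (𝟙 (adj? G u i) * colour i j)
      split i j = begin
        𝟙 (□-adj? i j) * colour i j
          ≡⟨ cong (_* colour i j) (𝟙-⊎ disjoint ((u ≟ i) ×-dec adj? H v j) ((v ≟ j) ×-dec adj? G u i)) ⟩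
        (𝟙 ((u ≟ i) ×-dec adj? H v j) + 𝟙 ((v ≟ j) ×-dec adj? G u i)) * colour i j
          ≡⟨ cong (λ k → k * colour i j) (cong₂ _+_ (𝟙-× (u ≟ i) (adj? H v j)) (𝟙-× (v ≟ j) (adj? G u i))) ⟩
        (𝟙 (u ≟ i) * 𝟙 (adj? H v j) + 𝟙 (v ≟ j) * 𝟙 (adj? G u i)) * colour i j
          ≡⟨ *-distribʳ-+ (colour i j) (𝟙 (u ≟ i) * 𝟙 (adj? H v j)) (𝟙 (v ≟ j) * 𝟙 (adj? G u i)) ⟩
        𝟙 (u ≟ i) * 𝟙 (adj? H v j) * colour i j + 𝟙 (v ≟ j) * 𝟙 (adj? G u i) * colour i j
          ≡⟨ cong₂ _+_ (*-assoc (𝟙 (u ≟ i)) _ _) (*-assoc (𝟙 (v ≟ j)) _ _) ⟩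
        𝟙 (u ≟ i) * (𝟙 (adj? H v j) * colour i j) + 𝟙 (v ≟ j) * (𝟙 (adj? G u i) * colour i j) ∎
        where
        disjoint : ¬ ((u ≡ i × Adj H v j) × (v ≡ j × Adj G u i))
        disjoint ((_ , vj) , (refl , _)) = irrefl H vj

    ⨯-nbrCount : ∀ x c → let u = fst n m x; v = snd n m x in
                 nbrCount (G ⨯ H) (ℓ₁ ⊞ ℓ₂) x c ≡ ∑[ i < n ] (𝟙 (adj? G u i) * nbrCount H ℓ₂ v (c ⊖ ℓ₁ i))
    ⨯-nbrCount x c = begin
      nbrCount (G ⨯ H) (ℓ₁ ⊞ ℓ₂) x c
        ≡⟨ nbrCount≡∑ (G ⨯ H) (ℓ₁ ⊞ ℓ₂) x c ⟩
      ∑[ y < n * m ] (𝟙 (adj? (G ⨯ H) x y) * 𝟙 ((ℓ₁ ⊞ ℓ₂) y ≟ c))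
        ≡⟨ ∑-remQuot n m (λ i j → 𝟙 (adj? G u i ×-dec adj? H v j) * colour i j) ⟩
      ∑[ i < n ] ∑[ j < m ] (𝟙 (adj? G u i ×-dec adj? H v j) * colour i j)
        ≡⟨ sum-cong-≗ (λ i → sum-cong-≗ (λ j → split i j)) ⟩
      ∑[ i < n ] ∑[ j < m ] (𝟙 (adj? G u i) * (𝟙 (adj? H v j) * colour i j))
        ≡⟨ sum-cong-≗ (λ i → *-distribˡ-sum (𝟙 (adj? G u i)) (λ j → 𝟙 (adj? H v j) * colour i j)) ⟨
      ∑[ i < n ] (𝟙 (adj? G u i) * ∑[ j < m ] (𝟙 (adj? H v j) * colour i j))
        ≡⟨ sum-cong-≗ (λ i → cong (𝟙 (adj? G u i) *_) (nbrCount-⊕ˡ H ℓ₂ v (ℓ₁ i) c)) ⟩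
      ∑[ i < n ] (𝟙 (adj? G u i) * nbrCount H ℓ₂ v (c ⊖ ℓ₁ i)) ∎
      where
      u : Fin n
      u = fst n m x
      v : Fin m
      v = snd n m x
      colour : Fin n → Fin m → ℕ
      colour i j = 𝟙 (ℓ₁ i ⊕ ℓ₂ j ≟ c)
      split : ∀ i j → 𝟙 (adj? G u i ×-dec adj? H v j) * colour i j ≡ 𝟙 (adj? G u i) * (𝟙 (adj? H v j) * colour i j)
      split i j = trans (cong (_* colour i j) (𝟙-× (adj? G u i) (adj? H v j)))
                        (*-assoc (𝟙 (adj? G u i)) (𝟙 (adj? H v j)) (colour i j))

    □-balanced : Balanced G ℓ₁ → Balanced H ℓ₂ → Balanced (G □ H) (ℓ₁ ⊞ ℓ₂)
    □-balanced bal₁ bal₂ x c d =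
      trans (□-nbrCount x c) (trans (cong₂ _+_ (bal₂ _ _ _) (bal₁ _ _ _)) (sym (□-nbrCount x d)))

    ⨯-balanced : Balanced H ℓ₂ → Balanced (G ⨯ H) (ℓ₁ ⊞ ℓ₂)
    ⨯-balanced bal₂ x c d =
      trans (⨯-nbrCount x c)
            (trans (sum-cong-≗ λ i → cong (𝟙 (adj? G (fst n m x) i) *_) (bal₂ _ _ _)) (sym (⨯-nbrCount x d)))

  ⊠-balanced : ∀ (ℓ : Colouring (n * m)) → Balanced (G □ H) ℓ → Balanced (G ⨯ H) ℓ → Balanced (G ⊠ H) ℓ
  ⊠-balanced ℓ bal□ bal⨯ x c d =
    trans (⊠-nbrCount ℓ x c) (trans (cong₂ _+_ (bal□ x c d) (bal⨯ x c d)) (sym (⊠-nbrCount ℓ x d)))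

theorem6p7 : ∀ {n m : ℕ} (G₁ : Graph n) (G₂ : Graph m) → ThreeBalanced G₁ → ThreeBalanced G₂ → ThreeBalanced (G₁ □ G₂) × ThreeBalanced (G₁ ⨯ G₂) × ThreeBalanced (G₁ ⊠ G₂)
theorem6p7 G₁ G₂ (ℓ₁ , bal₁) (ℓ₂ , bal₂) =
  (ℓ₁ ⊞ ℓ₂ , bal□) , (ℓ₁ ⊞ ℓ₂ , bal⨯) , (ℓ₁ ⊞ ℓ₂ , ⊠-balanced G₁ G₂ (ℓ₁ ⊞ ℓ₂) bal□ bal⨯)
  where
  bal□ : Balanced (G₁ □ G₂) (ℓ₁ ⊞ ℓ₂)
  bal□ = □-balanced G₁ G₂ ℓ₁ ℓ₂ bal₁ bal₂
  bal⨯ : Balanced (G₁ ⨯ G₂) (ℓ₁ ⊞ ℓ₂)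
  bal⨯ = ⨯-balanced G₁ G₂ ℓ₁ ℓ₂ bal₂
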